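{- Let $\varphi$ be a satisfiable CNF formula and let $\psi$ be the CNF formula consisting of all prime implicates of $\varphi$. Then $\varphi$ is a PC formula if and only if $\mathrm{DR}(\varphi)$ and $\mathrm{DR}(\psi)$ are equivalent (as Boolean functions of the meta-variables).
   Context: A partial assignment $\alpha$ of variables $\mathbf{x}$ is a set of literals on $\mathbf{x}$ with no complementary pair, identified with the conjunction of its literals. Unit resolution derives $C\setminus\{l\}$ from a clause $C\ni l$ and the unit clause $\neg l$; $\varphi\vdash_1 C$ means derivability by repeated unit resolution; $\bot$ is the empty clause. $\varphi(\mathbf{x})$ is propagation complete (PC) if for every partial assignment $\alpha$ of $\mathbf{x}$ and every literal $l$ on $\mathbf{x}$ with $\varphi\wedge\alpha\models l$ we have $\varphi\wedge\alpha\vdash_1 l$ or $\varphi\wedge\alpha\vdash_1\bot$. Implicational dual rail encoding: for a CNF $\varphi$ on variables $\mathbf{x}$ not containing the empty clause, introduce a meta-variable $\ell_l$ for every literal $l$ on $\mathbf{x}$ (so $2|\mathbf{x}|$ meta-variables). Then $\mathrm{DR}(\varphi)$ is the CNF on the meta-variables consisting of the clause $\ell_l\vee\bigvee_{e\in C\setminus\{l\}}\neg\ell_{\neg e}$ (i.e. the implication $\bigwedge_{e\in C\setminus\{l\}}\ell_{\neg e}\to\ell_l$) for every pair $(C,l)$ with $l\in C\in\varphi$, together with the consistency clauses $\neg\ell_x\vee\neg\ell_{\neg x}$ for every $x\in\mathbf{x}$. Here $\mathrm{DR}(\varphi)$ and $\mathrm{DR}(\psi)$ are on the same set of meta-variables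 (those of the variables of $\varphi$). -}

module Defs where

open import Data.Bool using (Bool; true; false; not)
open import Data.Fin using (Fin)
open import Data.List using (List; []; _∷_; _++_; map; filter; concatMap; allFin)
open import Data.List.Membership.Propositional using (_∈_)
open import Data.List.Relation.Unary.All using (All)
open import Data.List.Relation.Unary.Any using (Any)
open import Data.Sum using (_⊎_)
open import Data.Product using (Σ; _×_; _,_; ∃)
open import Relation.Binary.PropositionalEquality using (_≡_)
open import Relation.Binary using (DecidableEquality)
open import Relation.Nullary using (¬_)
open import Relation.Nullary.Decidable using (¬?)

-- Literals, clauses, CNFs over a variable type V
-- A literal (x , true) is the positive literal x, (x , false) is ¬x.

Lit : Set → Set
Lit V = V × Bool

neg : ∀ {V} → Lit V → Lit V
neg (x , b) = (x , not b)

Clause : Set → Set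
Clause V = List (Lit V)        -- read as the SET of its literals

CNF : Set → Set
CNF V = List (Clause V)        -- read as the set (conjunction) of its clauses

_⊆ᶜ_ : ∀ {V} → Clause V → Clause V → Set
C ⊆ᶜ D = ∀ l → l ∈ C → l ∈ D

_≈ᶜ_ : ∀ {V} → Clause V → Clause V → Set
C ≈ᶜ D = (C ⊆ᶜ D) × (D ⊆ᶜ C)

remove : ∀ {V} → DecidableEquality (Lit V) → Lit V → Clause V → Clause V
remove _≟_ l C = filter (λ e → ¬? (e ≟ l)) C

Assignment : Set → Set
Assignment V = V → Bool

litTrue : ∀ {V} → Assignment V → Lit V → Set
litTrue a (x , b) = a x ≡ b

clauseTrue : ∀ {V} → Assignment V → Clause V → Set
clauseTrue a C = Any (litTrue a) C

cnfTrue : ∀ {V} → Assignment V → CNF V → Set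
cnfTrue a φ = All (clauseTrue a) φ

Satisfiable : ∀ {V} → CNF V → Set
Satisfiable {V} φ = Σ (Assignment V) λ a → cnfTrue a φ

Implies : ∀ {V} → CNF V → Clause V → Set
Implies {V} φ C = (a : Assignment V) → cnfTrue a φ → clauseTrue a C

Equivalent : ∀ {V} → CNF V → CNF V → Set
Equivalent {V} φ ψ = (a : Assignment V) → (cnfTrue a φ → cnfTrue a ψ) × (cnfTrue a ψ → cnfTrue a φ)

Tautological : ∀ {V} → Clause V → Set
Tautological C = Σ _ λ l → (l ∈ C) × (neg l ∈ C)

PrimeImplicate : ∀ {V} → CNF V → Clause V → Set
PrimeImplicate φ C =
  ¬ Tautological C × Implies φ C ×
  (∀ D → D ⊆ᶜ C → ¬ (C ⊆ᶜ D) → ¬ Implies φ D)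

AllPrimeImplicates : ∀ {V} → CNF V → CNF V → Set
AllPrimeImplicates φ ψ =
  (∀ C → C ∈ ψ → PrimeImplicate φ C) ×
  (∀ C → PrimeImplicate φ C → Σ _ λ D → (D ∈ ψ) × (C ≈ᶜ D))

module UnitResolution {V : Set} (_≟_ : DecidableEquality (Lit V)) where

  data Derivation (F : CNF V) : Clause V → Set where
    axiom   : ∀ {C} → C ∈ F → Derivation F C
    resolve : ∀ {C U l} → Derivation F C → l ∈ C →
              Derivation F U → U ≈ᶜ (neg l ∷ []) →
              Derivation F (remove _≟_ l C)

  _⊢₁_ : CNF V → Clause V → Set
  F ⊢₁ E = Σ _ λ C → Derivation F C × (C ≈ᶜ E)

  -- partial assignments: sets of literals with no complementary pair
  Consistent : Clause V → Set
  Consistent α = ∀ l → l ∈ α → ¬ (neg l ∈ α)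

  _∧ᵖ_ : CNF V → List (Lit V) → CNF V
  φ ∧ᵖ α = φ ++ map (λ l → l ∷ []) α

  PropagationComplete : CNF V → Set
  PropagationComplete φ =
    ∀ (α : List (Lit V)) → Consistent α → ∀ (l : Lit V) →
      Implies (φ ∧ᵖ α) (l ∷ []) →
      ((φ ∧ᵖ α) ⊢₁ (l ∷ [])) ⊎ ((φ ∧ᵖ α) ⊢₁ [])

open import Data.Product.Properties using (≡-dec)
import Data.Fin as F
import Data.Bool as B

_≟ᴸ_ : ∀ {n} → DecidableEquality (Lit (Fin n))
_≟ᴸ_ = ≡-dec F._≟_ B._≟_

open UnitResolution public

PC : ∀ {n} → CNF (Fin n) → Set
PC {n} φ = PropagationComplete {Fin n} _≟ᴸ_ φ

-- Implicational dual rail encoding.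
-- Meta-variables are the literals of Fin n: meta-variable ℓ_l is l itself,
-- so DR(φ) is a CNF over the variable type Lit (Fin n).

pos : ∀ {n} → Lit (Fin n) → Lit (Lit (Fin n))
pos l = (l , true)

ngt : ∀ {n} → Lit (Fin n) → Lit (Lit (Fin n))
ngt l = (l , false)

drClause : ∀ {n} → Clause (Fin n) → Lit (Fin n) → Clause (Lit (Fin n))
drClause C l = pos l ∷ map (λ e → ngt (neg e)) (remove _≟ᴸ_ l C)

consistency : ∀ {n} → Fin n → Clause (Lit (Fin n))
consistency x = ngt (x , true) ∷ ngt (x , false) ∷ []

DR : ∀ {n} → CNF (Fin n) → CNF (Lit (Fin n))
DR {n} φ = concatMap (λ C → map (drClause C) C) φ ++ map consistency (allFin n)

-- A model of DR(φ) is a coherent set of literals closed under unit propagation through the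
-- clauses of φ. As every non-tautological implicate of φ contains a prime one, which is
-- non-empty because φ is satisfiable, closure under ψ yields closure under every implicate
-- of φ (under tautologies by coherence alone); so DR(ψ) ⊨ DR(φ) always. If φ is PC, unit
-- resolution from φ ∧ ¬(P ∖ {m}) derives m for each prime implicate P ∋ m, and unit
-- resolution is sound for closed coherent sets; so DR(φ) ⊨ DR(ψ). Conversely, saturate α
-- under unit propagation through φ: the saturation either contains a complementary pair,
-- and then φ ∧ α ⊢₁ ⊥, or it is a model of DR(φ), hence of DR(ψ), and closure under the
-- implicate l ∨ ¬α puts l into it.
module Submission where

open import Data.Bool using (true; false)
open import Data.Bool.Properties using (not-involutive; not-¬; ¬-not) renaming (_≟_ to _≟ᴮ_)
open import Data.Empty using (⊥; ⊥-elim)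
open import Data.Fin using (Fin)
open import Data.Fin.Subset.Properties using (anySubset?)
open import Data.List using (List; []; _∷_; length; map; concatMap; allFin; cartesianProduct)
open import Data.List.Membership.Propositional using (_∈_; _∉_; find; lose)
open import Data.List.Membership.Propositional.Properties
  using (∈-filter⁺; ∈-filter⁻; ∈-map⁺; ∈-map⁻; ∈-++⁺ˡ; ∈-++⁺ʳ; ∈-++⁻; ∈-allFin; ∈-cartesianProduct⁺)
open import Data.List.Properties using (filter-notAll)
open import Data.List.Relation.Unary.All as All using (All)
open import Data.List.Relation.Unary.All.Properties
  using (++⁺; ++⁻; map⁺; map⁻; concat⁺; concat⁻; tabulate⁺; tabulate⁻; ¬All⇒Any¬)
open import Data.List.Relation.Unary.Any as Any using (Any; here; there)
open import Data.List.Relation.Unary.Any.Properties as Anyₚ using ()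
open import Data.Nat using (ℕ; _<_)
open import Data.Nat.Induction using (<-wellFounded)
open import Data.Product using (Σ; _×_; _,_; proj₁; proj₂; ∃)
open import Data.Sum using (_⊎_; inj₁; inj₂)
open import Data.Vec using (lookup; tabulate)
open import Data.Vec.Properties using (lookup∘tabulate)
open import Function using (_∘_; _⇔_; mk⇔; Equivalence)
open import Induction.WellFounded using (Acc; acc)
open import Relation.Binary using (DecidableEquality)
open import Relation.Binary.PropositionalEquality using (_≡_; _≢_; refl; sym; trans; cong; subst)
open import Relation.Nullary using (¬_; Dec; does; yes; no; contradiction)
open import Relation.Nullary.Decidable using (¬?; _×-dec_; dec-true; decidable-stable)

open import Defs hiding (Derivation; axiom; resolve; _⊢₁_; Consistent; _∧ᵖ_; PropagationComplete)

module _ {V : Set} where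

  neg-involutive : (l : Lit V) → neg (neg l) ≡ l
  neg-involutive (x , b) = cong (x ,_) (not-involutive b)

  neg-injective : ∀ {l m : Lit V} → neg l ≡ neg m → l ≡ m
  neg-injective {l} {m} eq = trans (sym (neg-involutive l)) (trans (cong neg eq) (neg-involutive m))

  neg-≢ : (l : Lit V) → neg l ≢ l
  neg-≢ (x , b) eq = not-¬ refl (sym (cong proj₂ eq))

  litTrue? : (a : Assignment V) (l : Lit V) → Dec (litTrue a l)
  litTrue? a (x , b) = a x ≟ᴮ b

  clauseTrue? : (a : Assignment V) (C : Clause V) → Dec (clauseTrue a C)
  clauseTrue? a C = Any.any? (litTrue? a) C

  cnfTrue? : (a : Assignment V) (φ : CNF V) → Dec (cnfTrue a φ)
  cnfTrue? a φ = All.all? (clauseTrue? a) φ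

  litTrue-neg : (a : Assignment V) (l : Lit V) → ¬ litTrue a l → litTrue a (neg l)
  litTrue-neg a (x , b) = ¬-not

  ¬litTrue-neg : (a : Assignment V) (l : Lit V) → litTrue a l → ¬ litTrue a (neg l)
  ¬litTrue-neg a (x , b) = not-¬

  module _ {a b : Assignment V} (a≗b : ∀ x → a x ≡ b x) where

    litTrue-cong : ∀ l → litTrue a l → litTrue b l
    litTrue-cong (x , c) = trans (sym (a≗b x))

    clauseTrue-cong : ∀ C → clauseTrue a C → clauseTrue b C
    clauseTrue-cong C = Any.map (litTrue-cong _)

    cnfTrue-cong : ∀ φ → cnfTrue a φ → cnfTrue b φ
    cnfTrue-cong φ = All.map (clauseTrue-cong _)

  implies-∈ : ∀ {φ : CNF V} {C} → C ∈ φ → Implies φ C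
  implies-∈ C∈φ a aφ = All.lookup aφ C∈φ

  implies-⊆ : ∀ {φ : CNF V} {C D} → Implies φ C → C ⊆ᶜ D → Implies φ D
  implies-⊆ φ⊨C C⊆D a aφ with find (φ⊨C a aφ)
  ... | l , l∈C , al = lose (C⊆D l l∈C) al

  implicate-nonempty : ∀ {φ : CNF V} {C} → Satisfiable φ → Implies φ C → ∃ (_∈ C)
  implicate-nonempty (a , aφ) φ⊨C with find (φ⊨C a aφ)
  ... | l , l∈C , _ = l , l∈C

  -- A meta-assignment a : Assignment (Lit V) is read as the set of literals it makes
  -- true; a (neg e) ≡ true means that e is falsified.
  RefutedExcept : Assignment (Lit V) → Clause V → Lit V → Set
  RefutedExcept a D m = ∀ e → e ∈ D → e ≢ m → a (neg e) ≡ true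

  Refuted : Assignment (Lit V) → Clause V → Set
  Refuted a D = ∀ e → e ∈ D → a (neg e) ≡ true

  UnitClosed : Assignment (Lit V) → Clause V → Set
  UnitClosed a D = ∀ m → m ∈ D → RefutedExcept a D m → a m ≡ true

  Respects : Assignment (Lit V) → Clause V → Set
  Respects a D = UnitClosed a D × ¬ Refuted a D

  Coherent : Assignment (Lit V) → Set
  Coherent a = ∀ l → a l ≡ true → a (neg l) ≡ true → ⊥

  module _ {a : Assignment (Lit V)} where

    respects-≈ : ∀ {C D} → C ≈ᶜ D → Respects a C → Respects a D
    respects-≈ (C⊆D , D⊆C) (closed , ¬refuted) =
      (λ m m∈D r → closed m (D⊆C m m∈D) (λ e e∈C → r e (C⊆D e e∈C))) ,
      (λ r → ¬refuted (λ e e∈C → r e (C⊆D e e∈C)))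

    unitClosed⇒¬refuted : ∀ {D m} → Coherent a → m ∈ D → UnitClosed a D → ¬ Refuted a D
    unitClosed⇒¬refuted {m = m} coh m∈D closed r =
      coh m (closed m m∈D (λ e e∈D _ → r e e∈D)) (r m m∈D)

    respects-unit : ∀ {l} → Coherent a → a l ≡ true → Respects a (l ∷ [])
    respects-unit {l} coh al = closed , unitClosed⇒¬refuted coh (here refl) closed
      where
      closed : UnitClosed a (l ∷ [])
      closed _ (here refl) _ = al

    respects-unit⁻ : ∀ {l} → Respects a (l ∷ []) → a l ≡ true
    respects-unit⁻ (closed , _) = closed _ (here refl) (λ { e (here refl) e≢l → ⊥-elim (e≢l refl) })

    ¬respects-[] : ¬ Respects a []
    ¬respects-[] (_ , ¬refuted) = ¬refuted (λ _ ())

module UnitResolutionFacts {V : Set} (_≟_ : DecidableEquality (Lit V)) where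
  open UnitResolution _≟_
  open import Data.List.Membership.DecPropositional _≟_ using (_∈?_)

  ∈-remove⁻ : ∀ {x l} C → x ∈ remove _≟_ l C → x ∈ C × x ≢ l
  ∈-remove⁻ _ = ∈-filter⁻ (λ e → ¬? (e ≟ _))

  ∈-remove⁺ : ∀ {x l C} → x ∈ C → x ≢ l → x ∈ remove _≟_ l C
  ∈-remove⁺ = ∈-filter⁺ (λ e → ¬? (e ≟ _))

  length-remove-< : ∀ {l C} → l ∈ C → length (remove _≟_ l C) < length C
  length-remove-< {C = C} l∈C =
    filter-notAll (λ e → ¬? (e ≟ _)) C (Any.map (λ l≡e e≢l → e≢l (sym l≡e)) l∈C)

  tautological? : (C : Clause V) → Dec (Tautological C)
  tautological? C with Any.any? (λ l → neg l ∈? C) C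
  ... | yes t = yes (let l , l∈C , ¬l∈C = find t in l , l∈C , ¬l∈C)
  ... | no ¬t = no (λ (l , l∈C , ¬l∈C) → ¬t (lose l∈C ¬l∈C))

  module _ {a : Assignment (Lit V)} (coh : Coherent a) where

    unitClosed-tautology : ∀ {D} → Tautological D → UnitClosed a D
    unitClosed-tautology (x , x∈D , ¬x∈D) m _ r with x ≟ m | neg x ≟ m
    ... | yes refl | _ = subst (λ l → a l ≡ true) (neg-involutive x) (r (neg x) ¬x∈D (neg-≢ x))
    ... | no _ | yes refl = r x x∈D (λ x≡¬x → neg-≢ x (sym x≡¬x))
    ... | no x≢m | no ¬x≢m =
          ⊥-elim (coh (neg x) (r x x∈D x≢m) (r (neg x) ¬x∈D ¬x≢m))

    -- If m ∈ P, propagate through P at m; otherwise the literal p of P is forced true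
    -- although D refutes it.
    unitClosed-⊇ : ∀ {P D p} → UnitClosed a P → P ⊆ᶜ D → p ∈ P → UnitClosed a D
    unitClosed-⊇ {P} {p = p} closed P⊆D p∈P m m∈D r with m ∈? P
    ... | yes m∈P = closed m m∈P (λ e e∈P → r e (P⊆D e e∈P))
    ... | no m∉P = ⊥-elim (coh p ap (r p (P⊆D p p∈P) (λ { refl → m∉P p∈P })))
      where
      ap : a p ≡ true
      ap = closed p p∈P (λ e e∈P _ → r e (P⊆D e e∈P) (λ { refl → m∉P e∈P }))

    derivation-respects : ∀ {F D} → (∀ C → C ∈ F → Respects a C) → Derivation F D → Respects a D
    derivation-respects axioms (axiom C∈F) = axioms _ C∈F
    derivation-respects axioms (resolve {C} {_} {l} dC l∈C dU U≈¬l) = closed′ , ¬refuted′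
      where
      closed : UnitClosed a C
      closed = proj₁ (derivation-respects axioms dC)

      a¬l : a (neg l) ≡ true
      a¬l = respects-unit⁻ (respects-≈ U≈¬l (derivation-respects axioms dU))

      closed′ : UnitClosed a (remove _≟_ l C)
      closed′ m m∈ r = closed m (proj₁ (∈-remove⁻ C m∈)) refutedExcept
        where
        refutedExcept : RefutedExcept a C m
        refutedExcept e e∈C e≢m with e ≟ l
        ... | yes refl = a¬l
        ... | no e≢l = r e (∈-remove⁺ e∈C e≢l) e≢m

      ¬refuted′ : ¬ Refuted a (remove _≟_ l C)
      ¬refuted′ r = coh l (closed l l∈C (λ e e∈C e≢l → r e (∈-remove⁺ e∈C e≢l))) a¬l

    ⊢₁-respects : ∀ {F D} → (∀ C → C ∈ F → Respects a C) → F ⊢₁ D → Respects a D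
    ⊢₁-respects axioms (C , dC , C≈D) = respects-≈ C≈D (derivation-respects axioms dC)

  ⊢₁-axiom : ∀ {F C} → C ∈ F → F ⊢₁ C
  ⊢₁-axiom C∈F = _ , axiom C∈F , (λ _ p → p) , (λ _ p → p)

  ⊢₁-complementary : ∀ {F l} → F ⊢₁ (l ∷ []) → F ⊢₁ (neg l ∷ []) → F ⊢₁ []
  ⊢₁-complementary {l = l} (C , dC , C⊆l , l⊆C) (U , dU , U≈¬l) =
    remove _≟_ l C , resolve dC (l⊆C l (here refl)) dU U≈¬l , empty , (λ _ ())
    where
    empty : remove _≟_ l C ⊆ᶜ []
    empty x x∈ with ∈-remove⁻ C x∈
    ... | x∈C , x≢l with C⊆l x x∈C
    ...   | here x≡l = ⊥-elim (x≢l x≡l)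

  ⊆-∷-drop : ∀ {D : Clause V} {m e Ls} → D ⊆ᶜ (m ∷ e ∷ Ls) → (∀ x → x ∈ D → x ≡ e → x ≡ m) →
    D ⊆ᶜ (m ∷ Ls)
  ⊆-∷-drop D⊆ e⇒m x x∈D with D⊆ x x∈D
  ... | here x≡m = here x≡m
  ... | there (here x≡e) = here (e⇒m x x∈D x≡e)
  ... | there (there x∈Ls) = there x∈Ls

  -- Resolving the literals of Ls away one by one shrinks D down to the unit m.
  ⊢₁-propagate-along : ∀ {F D m} (Ls : Clause V) → (∀ e → e ∈ Ls → e ≢ m → F ⊢₁ (neg e ∷ [])) →
    Derivation F D → m ∈ D → D ⊆ᶜ (m ∷ Ls) → F ⊢₁ (m ∷ [])
  ⊢₁-propagate-along [] _ dD m∈D D⊆m = _ , dD , D⊆m , (λ { _ (here refl) → m∈D })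
  ⊢₁-propagate-along {D = D} {m} (e ∷ Ls) units dD m∈D D⊆ with e ≟ m | e ∈? D
  ... | yes refl | _ =
        ⊢₁-propagate-along Ls (λ e′ → units e′ ∘ there) dD m∈D (⊆-∷-drop D⊆ λ _ _ x≡e → x≡e)
  ... | no _ | no e∉D =
        ⊢₁-propagate-along Ls (λ e′ → units e′ ∘ there) dD m∈D
          (⊆-∷-drop D⊆ λ { _ x∈D refl → ⊥-elim (e∉D x∈D) })
  ... | no e≢m | yes e∈D with units e (here refl) e≢m
  ...   | U , dU , U≈¬e = ⊢₁-propagate-along Ls (λ e′ → units e′ ∘ there) (resolve dD e∈D dU U≈¬e)
          (∈-remove⁺ m∈D (λ m≡e → e≢m (sym m≡e)))
          (⊆-∷-drop (λ x x∈ → D⊆ x (proj₁ (∈-remove⁻ D x∈)))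
                    (λ x x∈ x≡e → ⊥-elim (proj₂ (∈-remove⁻ D x∈) x≡e)))

  ⊢₁-propagate : ∀ {F C m} → C ∈ F → m ∈ C → (∀ e → e ∈ C → e ≢ m → F ⊢₁ (neg e ∷ [])) →
    F ⊢₁ (m ∷ [])
  ⊢₁-propagate {C = C} C∈F m∈C units = ⊢₁-propagate-along C units (axiom C∈F) m∈C (λ _ → there)

  units-∈ : ∀ {α : List (Lit V)} {l} → l ∈ α → (l ∷ []) ∈ map (_∷ []) α
  units-∈ = ∈-map⁺ (_∷ [])

  implies-∧ᵖ⁺ : ∀ {φ : CNF V} {α l} → Implies φ (l ∷ map neg α) → Implies (φ ∧ᵖ α) (l ∷ [])
  implies-∧ᵖ⁺ {φ} φ⊨C a aφα with ++⁻ φ aφα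
  ... | aφ , aα with φ⊨C a aφ
  ...   | here al = here al
  ...   | there a¬α with find a¬α
  ...     | e , e∈ , ae with ∈-map⁻ neg e∈
  ...       | b , b∈α , refl with All.lookup aα (units-∈ b∈α)
  ...         | here ab = ⊥-elim (¬litTrue-neg a b ab ae)

  implies-∧ᵖ⁻ : ∀ {φ : CNF V} {α l} → Implies (φ ∧ᵖ α) (l ∷ []) → Implies φ (l ∷ map neg α)
  implies-∧ᵖ⁻ {α = α} φα⊨l a aφ with All.all? (litTrue? a) α
  ... | no ¬aα with find (¬All⇒Any¬ (litTrue? a) α ¬aα)
  ...   | b , b∈α , ¬ab = there (lose (∈-map⁺ neg b∈α) (litTrue-neg a b ¬ab))
  implies-∧ᵖ⁻ φα⊨l a aφ | yes aα with φα⊨l a (++⁺ aφ (map⁺ (All.map here aα)))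
  ...   | here al = here al

module _ {n : ℕ} where
  open UnitResolution (_≟ᴸ_ {n})
  open UnitResolutionFacts (_≟ᴸ_ {n})
  open import Data.List.Membership.DecPropositional (_≟ᴸ_ {n}) using (_∈?_)

  implies? : (φ : CNF (Fin n)) (D : Clause (Fin n)) → Dec (Implies φ D)
  implies? φ D with anySubset? (λ s → cnfTrue? (lookup s) φ ×-dec ¬? (clauseTrue? (lookup s) D))
  ... | yes (s , sφ , s⊭D) = no (λ φ⊨D → s⊭D (φ⊨D (lookup s) sφ))
  ... | no noCounterexample = yes λ a aφ → decidable-stable (clauseTrue? a D) λ a⊭D →
        noCounterexample (tabulate a , cnfTrue-cong (λ x → sym (lookup∘tabulate a x)) φ aφ ,
                          a⊭D ∘ clauseTrue-cong (lookup∘tabulate a) D)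

  Irredundant : CNF (Fin n) → Clause (Fin n) → Clause (Fin n) → Set
  Irredundant φ Ls P = ∀ x → x ∈ Ls → x ∈ P → ¬ Implies φ (remove _≟ᴸ_ x P)

  minimise : (φ : CNF (Fin n)) (Ls D : Clause (Fin n)) → Implies φ D →
    Σ (Clause (Fin n)) λ P → P ⊆ᶜ D × Implies φ P × Irredundant φ Ls P
  minimise φ [] D φ⊨D = D , (λ _ p → p) , φ⊨D , (λ _ ())
  minimise φ (x ∷ Ls) D φ⊨D with implies? φ (remove _≟ᴸ_ x D)
  ... | no φ⊭D-x with minimise φ Ls D φ⊨D
  ...   | P , P⊆D , φ⊨P , irredundant = P , P⊆D , φ⊨P , irredundant′
    where
    irredundant′ : Irredundant φ (x ∷ Ls) P
    irredundant′ _ (here refl) _ φ⊨P-x = φ⊭D-x (implies-⊆ φ⊨P-x λ y y∈ →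
      let y∈P , y≢x = ∈-remove⁻ P y∈ in ∈-remove⁺ (P⊆D y y∈P) y≢x)
    irredundant′ y (there y∈Ls) = irredundant y y∈Ls
  minimise φ (x ∷ Ls) D φ⊨D | yes φ⊨D-x with minimise φ Ls (remove _≟ᴸ_ x D) φ⊨D-x
  ... | P , P⊆D-x , φ⊨P , irredundant =
        P , (λ y y∈P → proj₁ (∈-remove⁻ D (P⊆D-x y y∈P))) , φ⊨P , irredundant′
    where
    irredundant′ : Irredundant φ (x ∷ Ls) P
    irredundant′ _ (here refl) x∈P = ⊥-elim (proj₂ (∈-remove⁻ D (P⊆D-x x x∈P)) refl)
    irredundant′ y (there y∈Ls) = irredundant y y∈Ls

  prime-implicate-⊆ : ∀ {φ D} → ¬ Tautological D → Implies φ D →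
    Σ (Clause (Fin n)) λ P → P ⊆ᶜ D × PrimeImplicate φ P
  prime-implicate-⊆ {φ} {D} ¬taut φ⊨D with minimise φ D D φ⊨D
  ... | P , P⊆D , φ⊨P , irredundant =
        P , P⊆D , (λ (l , l∈P , ¬l∈P) → ¬taut (l , P⊆D l l∈P , P⊆D (neg l) ¬l∈P)) , φ⊨P , minimal
    where
    minimal : ∀ Q → Q ⊆ᶜ P → ¬ (P ⊆ᶜ Q) → ¬ Implies φ Q
    minimal Q Q⊆P P⊈Q φ⊨Q = P⊈Q λ x x∈P → decidable-stable (x ∈? Q) λ x∉Q →
      irredundant x (P⊆D x x∈P) x∈P
        (implies-⊆ φ⊨Q λ y y∈Q → ∈-remove⁺ (Q⊆P y y∈Q) λ { refl → x∉Q y∈Q })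

  PropagationClosed : Assignment (Lit (Fin n)) → CNF (Fin n) → Set
  PropagationClosed a φ = Coherent a × (∀ C → C ∈ φ → UnitClosed a C)

  module _ {a : Assignment (Lit (Fin n))} where

    drClause-true⁻ : ∀ {C l} → clauseTrue a (drClause C l) → RefutedExcept a C l → a l ≡ true
    drClause-true⁻ (here al) _ = al
    drClause-true⁻ {C} (there a⊨¬C) r with find (Anyₚ.map⁻ a⊨¬C)
    ... | e , e∈ , a¬e≡false with ∈-remove⁻ C e∈
    ...   | e∈C , e≢l = contradiction (trans (sym (r e e∈C e≢l)) a¬e≡false) λ ()

    drClause-true⁺ : ∀ {C l} → (RefutedExcept a C l → a l ≡ true) → clauseTrue a (drClause C l)
    drClause-true⁺ {C} {l} propagate with a l ≟ᴮ true
    ... | yes al = here al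
    ... | no ¬al with All.all? (λ e → a (neg e) ≟ᴮ true) (remove _≟ᴸ_ l C)
    ...   | yes r = ⊥-elim (¬al (propagate λ e e∈C e≢l → All.lookup r (∈-remove⁺ e∈C e≢l)))
    ...   | no ¬r =
            there (Anyₚ.map⁺ (Any.map ¬-not (¬All⇒Any¬ (λ e → a (neg e) ≟ᴮ true) (remove _≟ᴸ_ l C) ¬r)))

    consistency-coherent : (∀ x → clauseTrue a (consistency x)) → Coherent a
    consistency-coherent cons (x , true) al a¬l with cons x
    ... | here f = not-¬ al f
    ... | there (here f) = not-¬ a¬l f
    consistency-coherent cons (x , false) al a¬l with cons x
    ... | here f = not-¬ a¬l f
    ... | there (here f) = not-¬ al f

    coherent-consistency : Coherent a → ∀ x → clauseTrue a (consistency x)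
    coherent-consistency coh x with a (x , true) ≟ᴮ true
    ... | yes ax = there (here (¬-not (coh (x , true) ax)))
    ... | no ¬ax = here (¬-not ¬ax)

    cnfTrue-DR⇔ : (φ : CNF (Fin n)) → cnfTrue a (DR φ) ⇔ PropagationClosed a φ
    cnfTrue-DR⇔ φ = mk⇔ to from
      where
      to : cnfTrue a (DR φ) → PropagationClosed a φ
      to a⊨DR with ++⁻ (concatMap (λ C → map (drClause C) C) φ) a⊨DR
      ... | a⊨drs , a⊨cons = consistency-coherent (tabulate⁻ (map⁻ a⊨cons)) , λ C C∈φ m m∈C →
            drClause-true⁻ (All.lookup (map⁻ (All.lookup (map⁻ (concat⁻ a⊨drs)) C∈φ)) m∈C)

      from : PropagationClosed a φ → cnfTrue a (DR φ)
      from (coh , closed) =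
        ++⁺ (concat⁺ (map⁺ (All.tabulate λ {C} C∈φ → map⁺ (All.tabulate λ {m} m∈C →
              drClause-true⁺ (closed C C∈φ m m∈C)))))
            (map⁺ (tabulate⁺ (coherent-consistency coh)))

  unitClosed-implicate : ∀ {φ ψ a D} → Satisfiable φ → AllPrimeImplicates φ ψ →
    PropagationClosed a ψ → Implies φ D → UnitClosed a D
  unitClosed-implicate {D = D} sat (_ , represented) (coh , closed) φ⊨D with tautological? D
  ... | yes taut = unitClosed-tautology coh taut
  ... | no ¬taut with prime-implicate-⊆ ¬taut φ⊨D
  ...   | P , P⊆D , prime with represented P prime | implicate-nonempty sat (proj₁ (proj₂ prime))
  ...     | Q , Q∈ψ , P⊆Q , Q⊆P | p , p∈P =
            unitClosed-⊇ coh (closed Q Q∈ψ) (λ x x∈Q → P⊆D x (Q⊆P x x∈Q)) (P⊆Q p p∈P)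

  pc-unitClosed : ∀ {φ a P} → PC φ → Satisfiable φ → PropagationClosed a φ → Implies φ P → UnitClosed a P
  pc-unitClosed {φ} {a} {P} pc sat (coh , closed) φ⊨P with tautological? P
  ... | yes taut = unitClosed-tautology coh taut
  ... | no ¬taut = forced
    where
    negatedRest : Lit (Fin n) → List (Lit (Fin n))
    negatedRest m = map neg (remove _≟ᴸ_ m P)

    consistent : ∀ m → Consistent (negatedRest m)
    consistent m _ l∈ ¬l∈ with ∈-map⁻ neg l∈ | ∈-map⁻ neg ¬l∈
    ... | e , e∈ , refl | e′ , e′∈ , ¬¬e≡¬e′ =
          ¬taut (e , proj₁ (∈-remove⁻ P e∈) ,
                 subst (_∈ P) (sym (neg-injective ¬¬e≡¬e′)) (proj₁ (∈-remove⁻ P e′∈)))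

    entails : ∀ m → Implies (φ ∧ᵖ negatedRest m) (m ∷ [])
    entails m = implies-∧ᵖ⁺ (implies-⊆ φ⊨P P⊆)
      where
      P⊆ : P ⊆ᶜ (m ∷ map neg (negatedRest m))
      P⊆ x x∈P with x ≟ᴸ m
      ... | yes x≡m = here x≡m
      ... | no x≢m = there (subst (_∈ map neg (negatedRest m)) (neg-involutive x)
                             (∈-map⁺ neg (∈-map⁺ neg (∈-remove⁺ x∈P x≢m))))

    axioms : ∀ {m} → RefutedExcept a P m → ∀ C → C ∈ φ ∧ᵖ negatedRest m → Respects a C
    axioms {m} r C C∈ with ∈-++⁻ φ C∈
    ... | inj₁ C∈φ = closed C C∈φ ,
          unitClosed⇒¬refuted coh (proj₂ (implicate-nonempty sat (implies-∈ C∈φ))) (closed C C∈φ)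
    ... | inj₂ C∈units with ∈-map⁻ (_∷ []) C∈units
    ...   | _ , ¬e∈ , refl with ∈-map⁻ neg ¬e∈
    ...     | e , e∈ , refl with ∈-remove⁻ P e∈
    ...       | e∈P , e≢m = respects-unit coh (r e e∈P e≢m)

    forced : UnitClosed a P
    forced m _ r with pc (negatedRest m) (consistent m) m (entails m)
    ... | inj₁ ⊢m = respects-unit⁻ (⊢₁-respects coh (axioms r) ⊢m)
    ... | inj₂ ⊢⊥ = ⊥-elim (¬respects-[] (⊢₁-respects coh (axioms r) ⊢⊥))

  PC⇒propagationClosed-ψ : ∀ {φ ψ a} → PC φ → Satisfiable φ → AllPrimeImplicates φ ψ →
    PropagationClosed a φ → PropagationClosed a ψ
  PC⇒propagationClosed-ψ pc sat (prime , _) closedφ@(coh , _) =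
    coh , λ P P∈ψ → pc-unitClosed pc sat closedφ (proj₁ (proj₂ (prime P P∈ψ)))

  propagationClosed-ψ⇒φ : ∀ {φ ψ a} → Satisfiable φ → AllPrimeImplicates φ ψ →
    PropagationClosed a ψ → PropagationClosed a φ
  propagationClosed-ψ⇒φ sat ap closedψ@(coh , _) =
    coh , λ C C∈φ → unitClosed-implicate sat ap closedψ (implies-∈ C∈φ)

  allLits : List (Lit (Fin n))
  allLits = cartesianProduct (allFin n) (true ∷ false ∷ [])

  ∈-allLits : ∀ l → l ∈ allLits
  ∈-allLits (x , true) = ∈-cartesianProduct⁺ (∈-allFin x) (here refl)
  ∈-allLits (x , false) = ∈-cartesianProduct⁺ (∈-allFin x) (there (here refl))

  indicator : List (Lit (Fin n)) → Assignment (Lit (Fin n))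
  indicator S m = does (m ∈? S)

  ∈-indicator⁻ : ∀ {S m} → indicator S m ≡ true → m ∈ S
  ∈-indicator⁻ {S} {m} eq with m ∈? S
  ... | yes m∈S = m∈S
  ... | no _ = contradiction eq λ ()

  ∈-indicator⁺ : ∀ {S m} → m ∈ S → indicator S m ≡ true
  ∈-indicator⁺ {S} {m} = dec-true (m ∈? S)

  module Saturation (φ : CNF (Fin n)) (α : List (Lit (Fin n))) where

    Derivable : List (Lit (Fin n)) → Set
    Derivable S = ∀ m → m ∈ S → (φ ∧ᵖ α) ⊢₁ (m ∷ [])

    Propagated : List (Lit (Fin n)) → Lit (Fin n) → Set
    Propagated S m = Σ (Clause (Fin n)) λ C → C ∈ φ × m ∈ C × (∀ e → e ∈ C → e ≢ m → neg e ∈ S)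

    Closed : List (Lit (Fin n)) → Set
    Closed S = ∀ m → Propagated S m → m ∈ S

    closed-or-extensible : ∀ S → Closed S ⊎ Σ (Lit (Fin n)) λ m → m ∉ S × Propagated S m
    closed-or-extensible S with Any.any? (λ C → Any.any? (λ m → ¬? (m ∈? S) ×-dec
                                   All.all? (λ e → neg e ∈? S) (remove _≟ᴸ_ m C)) C) φ
    ... | no ¬extensible = inj₁ λ m (C , C∈φ , m∈C , refuted) → decidable-stable (m ∈? S) λ m∉S →
          ¬extensible (lose C∈φ (lose m∈C (m∉S , All.tabulate λ e∈ →
            let e∈C , e≢m = ∈-remove⁻ C e∈ in refuted _ e∈C e≢m)))
    ... | yes extensible with find extensible
    ...   | C , C∈φ , extensibleAtC with find extensibleAtC
    ...     | m , m∈C , m∉S , refuted =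
              inj₂ (m , m∉S , C , C∈φ , m∈C , λ e e∈C e≢m → All.lookup refuted (∈-remove⁺ e∈C e≢m))

    -- U over-approximates the literals outside S; it shrinks at every extension.
    saturate-from : ∀ S (U : List (Lit (Fin n))) → Acc _<_ (length U) → (∀ m → m ∉ S → m ∈ U) →
      Derivable S → Σ (List (Lit (Fin n))) λ S′ → S ⊆ᶜ S′ × Derivable S′ × Closed S′
    saturate-from S U (acc smaller) outside⊆U derivable with closed-or-extensible S
    ... | inj₁ closed = S , (λ _ m∈S → m∈S) , derivable , closed
    ... | inj₂ (m , m∉S , C , C∈φ , m∈C , refuted) =
          extend (saturate-from (m ∷ S) (remove _≟ᴸ_ m U) (smaller (length-remove-< (outside⊆U m m∉S)))
                   outside⊆U′ derivable′)
      where
      outside⊆U′ : ∀ x → x ∉ m ∷ S → x ∈ remove _≟ᴸ_ m U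
      outside⊆U′ x x∉ = ∈-remove⁺ (outside⊆U x (x∉ ∘ there)) (x∉ ∘ here)

      derivable′ : Derivable (m ∷ S)
      derivable′ _ (here refl) =
        ⊢₁-propagate (∈-++⁺ˡ C∈φ) m∈C λ e e∈C e≢m → derivable (neg e) (refuted e e∈C e≢m)
      derivable′ x (there x∈S) = derivable x x∈S

      extend : (Σ (List (Lit (Fin n))) λ S′ → (m ∷ S) ⊆ᶜ S′ × Derivable S′ × Closed S′) →
               Σ (List (Lit (Fin n))) λ S′ → S ⊆ᶜ S′ × Derivable S′ × Closed S′
      extend (S′ , m∷S⊆S′ , derivable , closed) =
        S′ , (λ x x∈S → m∷S⊆S′ x (there x∈S)) , derivable , closed

    saturate : Σ (List (Lit (Fin n))) λ S → α ⊆ᶜ S × Derivable S × Closed S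
    saturate = saturate-from α allLits (<-wellFounded _) (λ m _ → ∈-allLits m)
                 (λ m m∈α → ⊢₁-axiom (∈-++⁺ʳ φ (units-∈ m∈α)))

  DR-equivalent⇒PC : ∀ {φ ψ} → Satisfiable φ → AllPrimeImplicates φ ψ → Equivalent (DR φ) (DR ψ) → PC φ
  DR-equivalent⇒PC {φ} {ψ} sat ap equivalent α _ l φα⊨l with Saturation.saturate φ α
  ... | S , α⊆S , derivable , closed with Any.any? (λ m → neg m ∈? S) S
  ... | yes clash = let m , m∈S , ¬m∈S = find clash in
                    inj₂ (⊢₁-complementary (derivable m m∈S) (derivable (neg m) ¬m∈S))
  ... | no noClash =
        inj₁ (derivable l (∈-indicator⁻
          (unitClosed-implicate sat ap closedψ (implies-∧ᵖ⁻ φα⊨l) l (here refl) refuted)))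
    where
    coh : Coherent (indicator S)
    coh m am a¬m = noClash (lose (∈-indicator⁻ am) (∈-indicator⁻ a¬m))

    closedφ : PropagationClosed (indicator S) φ
    closedφ = coh , λ C C∈φ m m∈C r →
      ∈-indicator⁺ (closed m (C , C∈φ , m∈C , λ e e∈C e≢m → ∈-indicator⁻ (r e e∈C e≢m)))

    closedψ : PropagationClosed (indicator S) ψ
    closedψ = Equivalence.to (cnfTrue-DR⇔ ψ)
      (proj₁ (equivalent (indicator S)) (Equivalence.from (cnfTrue-DR⇔ φ) closedφ))

    refuted : RefutedExcept (indicator S) (l ∷ map neg α) l
    refuted _ (here refl) e≢l = ⊥-elim (e≢l refl)
    refuted _ (there e∈) _ with ∈-map⁻ neg e∈
    ... | b , b∈α , refl = ∈-indicator⁺ (subst (_∈ S) (sym (neg-involutive b)) (α⊆S b b∈α))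

theorem5 : (n : ℕ) (φ ψ : CNF (Fin n)) →
    Satisfiable φ → AllPrimeImplicates φ ψ →
    (PC φ → Equivalent (DR φ) (DR ψ)) × (Equivalent (DR φ) (DR ψ) → PC φ)
theorem5 n φ ψ sat ap = PC⇒DR-equivalent , DR-equivalent⇒PC sat ap
  where
  open Equivalence

  PC⇒DR-equivalent : PC φ → Equivalent (DR φ) (DR ψ)
  PC⇒DR-equivalent pc a =
    (λ a⊨DRφ → from (cnfTrue-DR⇔ ψ) (PC⇒propagationClosed-ψ pc sat ap (to (cnfTrue-DR⇔ φ) a⊨DRφ))) ,
    (λ a⊨DRψ → from (cnfTrue-DR⇔ φ) (propagationClosed-ψ⇒φ sat ap (to (cnfTrue-DR⇔ ψ) a⊨DRψ)))
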